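{- Let $\psi \in (\mathcal{P}(\mathcal{P} A))^{S}$ and $\varphi \in (\mathcal{P}(\mathcal{P} A))^{\mathcal{P} S}$ be such that, for all $X \in \mathcal{P} S$, $\varphi(X) = \bigcup_{x \in X} \psi(x)$. Then $[\![\psi]\!]_{2} = [\![\varphi]\!]_{1}$.
   Context: Let $(S,t\colon S\to\mathcal{P}(S)^A)$ be a finite LTS with set of initial states $i\subseteq S$, and write $t^\sharp(X)(a)=\bigcup_{x\in X}t(x)(a)$ for $X\subseteq S$. Consider the Moore machine $\mathcal{M}_R$ with states $\varphi\in\mathcal{P}(\mathcal{P}(A))^{\mathcal{P}S}$, output $o_R^\sharp(\varphi)=\varphi(i)$ and transitions $t_R^\sharp(\varphi)(a)(X)=\varphi(t^\sharp(X)(a))$, with semantic map $[\![-]\!]_1\colon\mathcal{P}(\mathcal{P}(A))^{\mathcal{P}S}\to\mathcal{P}(\mathcal{P}(A))^{A^*}$, $[\![\varphi]\!]_1(\varepsilon)=o_R^\sharp(\varphi)$, $[\![\varphi]\!]_1(aw)=[\![t_R^\sharp(\varphi)(a)]\!]_1(w)$. Consider also the Moore machine $\overline{\mathcal{M}}_R$ with states $\psi\in\mathcal{P}(\mathcal{P}(A))^S$, output $\overline{o}_R(\psi)=\bigcup_{x\in i}\psi(x)$ and transitions $\overline{t}_R(\psi)(a)(x)=\bigcup_{y\in t(x)(a)}\psi(y)$, with semantic map $[\![-]\!]_2$ defined analogously. (These are the "reverse and determinise" constructions used in Brzozowski's algorithm for failure semantics.) -}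

module Defs where

open import Data.Nat using (ℕ; zero; suc)
open import Data.Bool using (Bool; true; false; _∧_; _∨_)
open import Data.Fin using (Fin; zero; suc)
open import Data.Fin.Subset using (Subset; _∈_)
open import Data.Vec using (lookup; tabulate)
open import Data.List using (List; []; _∷_)

-- Finite sets: S = Fin n (states), A = Fin k (alphabet).
-- 𝒫 X for finite X = Fin m is the stdlib 'Subset m' (Vec Bool m).
-- 𝒫(𝒫 A) is represented by its characteristic function  Subset k → Bool.
PPA : ℕ → Set
PPA k = Subset k → Bool

anyFin : ∀ {n} → (Fin n → Bool) → Bool
anyFin {zero}  f = false
anyFin {suc n} f = f zero ∨ anyFin (λ x → f (suc x))

⋃PP : ∀ {n k} → Subset n → (Fin n → PPA k) → PPA k
⋃PP X f U = anyFin (λ x → lookup X x ∧ f x U)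

⋃S : ∀ {n} → Subset n → (Fin n → Subset n) → Subset n
⋃S X g = tabulate (λ y → anyFin (λ x → lookup X x ∧ lookup (g x) y))

record LTS (n k : ℕ) : Set where
  field
    t : Fin n → Fin k → Subset n
    i : Subset n

record Moore (k : ℕ) (Q O : Set) : Set where
  field
    out  : Q → O
    next : Q → Fin k → Q

⟦_⟧ : ∀ {k Q O} → Moore k Q O → Q → List (Fin k) → O
⟦ M ⟧ q []      = Moore.out M q
⟦ M ⟧ q (a ∷ w) = ⟦ M ⟧ (Moore.next M q a) w

module _ {n k : ℕ} (L : LTS n k) where
  open LTS L

  t♯ : Subset n → Fin k → Subset n
  t♯ X a = ⋃S X (λ x → t x a)

  M-R : Moore k (Subset n → PPA k) (PPA k)
  M-R = record
    { out  = λ φ → φ i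
    ; next = λ φ a X → φ (t♯ X a) }

  M̄-R : Moore k (Fin n → PPA k) (PPA k)
  M̄-R = record
    { out  = λ ψ → ⋃PP i ψ
    ; next = λ ψ a x → ⋃PP (t x a) ψ }

  ⟦_⟧₁ : (Subset n → PPA k) → List (Fin k) → PPA k
  ⟦_⟧₁ = ⟦ M-R ⟧

  ⟦_⟧₂ : (Fin n → PPA k) → List (Fin k) → PPA k
  ⟦_⟧₂ = ⟦ M̄-R ⟧

module Submission where

-- Being related is a bisimulation-like invariant:
--   * outputs agree, since o(ψ) = ⋃_{x∈i} ψ(x) = φ(i);
--   * it is preserved by every a-transition, because unions of unions
--     reassociate: ⋃_{y ∈ ⋃_{x∈X} t(x)(a)} ψ(y) = ⋃_{x∈X} ⋃_{y∈t(x)(a)} ψ(y).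
-- A general coinduction principle for Moore machines (any relation on
-- states with related outputs that is closed under transitions relates the
-- semantics) then gives the result.

open import Defs
open import Data.Nat using (ℕ; zero; suc)
open import Data.Fin using (Fin; zero; suc)
open import Data.Fin.Subset using (Subset)
open import Data.List using (List; []; _∷_)
open import Data.Bool using (Bool; false; _∧_; _∨_)
open import Data.Bool.Properties
  using (∧-assoc; ∧-zeroʳ; ∧-distribˡ-∨; ∧-distribʳ-∨; ∨-commutativeMonoid)
open import Data.Vec using (lookup; tabulate)
open import Data.Vec.Properties using (lookup∘tabulate)
open import Algebra.Bundles using (CommutativeMonoid)
open import Algebra.Properties.CommutativeSemigroup
  (CommutativeMonoid.commutativeSemigroup ∨-commutativeMonoid) using (interchange)
open import Relation.Binary.PropositionalEquality
open ≡-Reasoning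

any-cong : ∀ {n} {f g : Fin n → Bool} → (∀ x → f x ≡ g x) → anyFin f ≡ anyFin g
any-cong {zero}  e = refl
any-cong {suc n} e = cong₂ _∨_ (e zero) (any-cong (λ x → e (suc x)))

any-∧ʳ : ∀ {n} (f : Fin n → Bool) b → anyFin f ∧ b ≡ anyFin (λ x → f x ∧ b)
any-∧ʳ {zero}  f b = refl
any-∧ʳ {suc n} f b =
  trans (∧-distribʳ-∨ b (f zero) _) (cong (f zero ∧ b ∨_) (any-∧ʳ (λ x → f (suc x)) b))

any-∧ˡ : ∀ {n} b (f : Fin n → Bool) → b ∧ anyFin f ≡ anyFin (λ x → b ∧ f x)
any-∧ˡ {zero}  b f = ∧-zeroʳ b
any-∧ˡ {suc n} b f =
  trans (∧-distribˡ-∨ b (f zero) _) (cong (b ∧ f zero ∨_) (any-∧ˡ b (λ x → f (suc x))))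

any-∨ : ∀ {n} (f g : Fin n → Bool) → anyFin (λ x → f x ∨ g x) ≡ anyFin f ∨ anyFin g
any-∨ {zero}  f g = refl
any-∨ {suc n} f g = begin
    (f zero ∨ g zero) ∨ anyFin (λ x → f (suc x) ∨ g (suc x))
  ≡⟨ cong ((f zero ∨ g zero) ∨_) (any-∨ (λ x → f (suc x)) (λ x → g (suc x))) ⟩
    (f zero ∨ g zero) ∨ (anyFin (λ x → f (suc x)) ∨ anyFin (λ x → g (suc x)))
  ≡⟨ interchange (f zero) (g zero) _ _ ⟩
    (f zero ∨ anyFin (λ x → f (suc x))) ∨ (g zero ∨ anyFin (λ x → g (suc x))) ∎

any-false : ∀ n → anyFin {n} (λ _ → false) ≡ false
any-false zero    = refl
any-false (suc n) = any-false n

any-swap : ∀ {n m} (g : Fin n → Fin m → Bool) →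
  anyFin (λ x → anyFin (g x)) ≡ anyFin (λ y → anyFin (λ x → g x y))
any-swap {zero}  {m} g = sym (any-false m)
any-swap {suc n} {m} g = begin
    anyFin (g zero) ∨ anyFin (λ x → anyFin (g (suc x)))
  ≡⟨ cong (anyFin (g zero) ∨_) (any-swap (λ x → g (suc x))) ⟩
    anyFin (g zero) ∨ anyFin (λ y → anyFin (λ x → g (suc x) y))
  ≡⟨ sym (any-∨ (g zero) _) ⟩
    anyFin (λ y → g zero y ∨ anyFin (λ x → g (suc x) y)) ∎

⋃PP-⋃S : ∀ {n k} (X : Subset n) (g : Fin n → Subset n) (ψ : Fin n → PPA k) (U : Subset k) →
  ⋃PP (⋃S X g) ψ U ≡ ⋃PP X (λ x → ⋃PP (g x) ψ) U
⋃PP-⋃S {n} X g ψ U = begin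
    anyFin (λ y → lookup (⋃S X g) y ∧ ψ y U)
  ≡⟨ any-cong (λ y → cong (_∧ ψ y U) (lookup∘tabulate _ y)) ⟩
    anyFin (λ y → anyFin (λ x → member x y) ∧ ψ y U)
  ≡⟨ any-cong (λ y → any-∧ʳ (λ x → member x y) (ψ y U)) ⟩
    anyFin (λ y → anyFin (λ x → member x y ∧ ψ y U))
  ≡⟨ sym (any-swap (λ x y → member x y ∧ ψ y U)) ⟩
    anyFin (λ x → anyFin (λ y → member x y ∧ ψ y U))
  ≡⟨ any-cong (λ x → any-cong (λ y → ∧-assoc (lookup X x) (lookup (g x) y) (ψ y U))) ⟩
    anyFin (λ x → anyFin (λ y → lookup X x ∧ (lookup (g x) y ∧ ψ y U)))
  ≡⟨ any-cong (λ x → sym (any-∧ˡ (lookup X x) (λ y → lookup (g x) y ∧ ψ y U))) ⟩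
    anyFin (λ x → lookup X x ∧ anyFin (λ y → lookup (g x) y ∧ ψ y U)) ∎
  where
  member : Fin n → Fin n → Bool
  member x y = lookup X x ∧ lookup (g x) y

moore-coinduction : ∀ {k} {Q₁ Q₂ O : Set} (M₁ : Moore k Q₁ O) (M₂ : Moore k Q₂ O)
  (R : Q₁ → Q₂ → Set) (_≈_ : O → O → Set) →
  (∀ {q₁ q₂} → R q₁ q₂ → Moore.out M₁ q₁ ≈ Moore.out M₂ q₂) →
  (∀ {q₁ q₂} → R q₁ q₂ → ∀ a → R (Moore.next M₁ q₁ a) (Moore.next M₂ q₂ a)) →
  ∀ {q₁ q₂} → R q₁ q₂ → ∀ w → ⟦ M₁ ⟧ q₁ w ≈ ⟦ M₂ ⟧ q₂ w
moore-coinduction M₁ M₂ R _≈_ out≈ next-R r []      = out≈ r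
moore-coinduction M₁ M₂ R _≈_ out≈ next-R r (a ∷ w) =
  moore-coinduction M₁ M₂ R _≈_ out≈ next-R (next-R r a) w

Extends : ∀ {n k} → (Fin n → PPA k) → (Subset n → PPA k) → Set
Extends ψ φ = ∀ X U → φ X U ≡ ⋃PP X ψ U

lemma5p1 : ∀ {n k : ℕ} (L : LTS n k) (ψ : Fin n → PPA k) (φ : Subset n → PPA k) →
    (∀ (X : Subset n) (U : Subset k) → φ X U ≡ ⋃PP X ψ U) →
    ∀ (w : List (Fin k)) (U : Subset k) → ⟦_⟧₂ L ψ w U ≡ ⟦_⟧₁ L φ w U
lemma5p1 L ψ φ ext w =
  moore-coinduction (M̄-R L) (M-R L) Extends (λ o o′ → ∀ U → o U ≡ o′ U)
    outputs-agree transitions-preserve ext w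
  where
  open LTS L
  outputs-agree : ∀ {ψ φ} → Extends ψ φ → ∀ U → ⋃PP i ψ U ≡ φ i U
  outputs-agree e U = sym (e i U)
  transitions-preserve : ∀ {ψ φ} → Extends ψ φ → ∀ a →
    Extends (λ x → ⋃PP (t x a) ψ) (λ X → φ (t♯ L X a))
  transitions-preserve {ψ} e a X U = trans (e (t♯ L X a) U) (⋃PP-⋃S X (λ x → t x a) ψ U)
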